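{- Let $p$ be an odd prime and $k\in\mathbb{N}_{+}$, and let $A_{p,k}(n)$ be defined by $$\prod_{m=0}^{\infty}\frac{1}{\left(1-x^{p^{m}}\right)^{k}}=\sum_{n=0}^{\infty}A_{p,k}(n)x^{n}.$$ Suppose that the sequence $(\nu_{p}(A_{p,k}(n)))_{n\in\mathbb{N}}$ is eventually constant and equal to $1$. Then: (a) If $p-1\mid k$, then $p\nmid k$. (b) If $p-1\nmid k$, $k=(p-1)k'+q$ for some $k'\in\mathbb{N}$ and $q\in\{1,\ldots,p-2\}$, and $p\mid k'+1$, then $p^{2}\nmid k'+1$.
   Context: $\mathbb{N}=\{0,1,2,\ldots\}$, $\mathbb{N}_{+}=\{1,2,\ldots\}$. $\nu_{p}(m)$ denotes the $p$-adic valuation of an integer $m$ (largest $t$ with $p^t\mid m$), with $\nu_p(0)=+\infty$. -}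

module Defs where

open import Data.Nat using (ℕ; zero; suc; _+_; _*_; _∸_; _^_; _≤_; _≤?_)
open import Data.Nat.Divisibility using (_∣_)
open import Data.Nat.Combinatorics using (_C_)
open import Data.List using (upTo; map)
open import Data.Nat.ListAction using (sum)
open import Data.Product using (_×_)
open import Relation.Nullary using (¬_; yes; no)

-- Coefficient of x^n in ∏_{m=0}^{M-1} (1 - x^{p^m})^{-k}.
-- (1 - y)^{-k} = Σ_j C(j+k-1, k-1) y^j  (for k ≥ 1).
-- coeff p k (suc M) n = Σ_{j ≥ 0, p^M j ≤ n} C(j+k-1,k-1) · coeff p k M (n - p^M j).
coeff : (p k M n : ℕ) → ℕ
coeff p k zero zero = 1
coeff p k zero (suc n) = 0
coeff p k (suc M) n = sum (map term (upTo (suc n)))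
  where
  term : ℕ → ℕ
  term j with p ^ M * j ≤? n
  ... | yes _ = ((j + k ∸ 1) C (k ∸ 1)) * coeff p k M (n ∸ p ^ M * j)
  ... | no  _ = 0

-- A_{p,k}(n): coefficient of x^n in ∏_{m≥0} (1 - x^{p^m})^{-k}.
-- Factors with p^m > n do not affect the coefficient of x^n; since
-- p^m > n for m ≥ n+1 (p ≥ 2), the first n+1 factors suffice.
A : (p k n : ℕ) → ℕ
A p k n = coeff p k (suc n) n

HasValuation : (p t m : ℕ) → Set
HasValuation p t m = (p ^ t ∣ m) × ¬ (p ^ suc t ∣ m)

-- Write F(x) = Σ A(n) xⁿ. Then (1 - x)ᵏ F(x) = F(xᵖ). If p divides A(n) for all large n, let d be
-- the last index with p ∤ A(d): the last coefficient of (1 - x)ᵏ F not divisible by p sits at d + k,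
-- while the last one of F(xᵖ) sits at d p, so k = d (p - 1). In particular p - 1 ∣ k always, which
-- makes part (b) vacuous. If moreover p ∣ k, then k = e p (p - 1). Since (1 - x)ᵖ ≡ 1 - xᵖ (mod p),
-- lifting the exponent gives (1 - x)^(p²) ≡ (1 - xᵖ)ᵖ (mod p²), so G = (1 - x)^(e p) satisfies the
-- same functional congruence (1 - x)ᵏ G(x) ≡ G(xᵖ) (mod p²). That congruence determines a series
-- modulo p² from its constant term, hence F ≡ G (mod p²), and p² divides A(n) for every n > e p,
-- contradicting ν_p(A(n)) = 1.
module Submission where

open import Defs
open import Data.Nat
  using (ℕ; zero; suc; _+_; _*_; _∸_; _^_; _≤_; _<_; _≤?_; z≤n; s≤s; NonZero; NonTrivial;
         >-nonZero⁻¹; nonTrivial⇒nonZero; nonTrivial⇒n>1; nonTrivial⇒≢1)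
open import Data.Nat.Properties
open import Data.Nat.Divisibility using (_∣_; divides; _∣?_; ∣⇒≤; ∣m∸n∣n⇒∣m; ∣1⇒≡1)
open import Data.Nat.Induction using (<-rec)
open import Data.Nat.Primality using (Prime; euclidsLemma; composite-≢; prime⇒nonZero; prime⇒nonTrivial)
open import Data.Nat.Combinatorics using (_C_; nCk+nC[k+1]≡[n+1]C[k+1]; k>n⇒nCk≡0; nCn≡1; nC1≡n)
open import Data.Nat.ListAction using (sum)
import Data.Nat.Tactic.RingSolver as ℕ-Solver
open import Data.List using (map; applyUpTo; upTo)
open import Data.Integer as ℤ using (ℤ; +_; 0ℤ; 1ℤ; -1ℤ)
import Data.Integer.Properties as ℤₚ
open import Data.Integer.Divisibility.Signed
  using (divides; ∣ᵤ⇒∣; ∣⇒∣ᵤ; 0∣⇒≡0; ∣m∣n⇒∣m+n; ∣m∣n⇒∣m-n; ∣n⇒∣m*n; ∣m⇒∣m*n)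
  renaming (_∣_ to _∣ℤ_; _∣?_ to _∣ℤ?_)
open import Data.Integer.Tactic.RingSolver using (solve-∀)
open import Data.Product using (Σ; _×_; _,_; proj₁; proj₂; ∃-syntax)
open import Data.Sum using (inj₁; inj₂)
open import Data.Empty using (⊥-elim)
open import Function using (_∘_)
open import Relation.Nullary using (¬_; yes; no)
open import Relation.Unary using (Pred; Decidable)
open import Relation.Binary.PropositionalEquality

-- Sequences and linear operators

-- A sequence f stands for the power series Σ f(n) xⁿ; below, shift q, Δ q and dilate p are
-- multiplication by x^q, multiplication by 1 - x^q and the substitution x ↦ xᵖ.
Seq : Set
Seq = ℕ → ℤ

Op : Set
Op = Seq → Seq

infixl 6 _⊕_ _⊖_
infixl 7 _⊛_

_⊕_ _⊖_ : Seq → Seq → Seq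
(f ⊕ g) n = f n ℤ.+ g n
(f ⊖ g) n = f n ℤ.- g n

_⊛_ : ℤ → Seq → Seq
(c ⊛ f) n = c ℤ.* f n

record Linear (X : Op) : Set where
  field
    cong-≗ : ∀ {f g} → f ≗ g → X f ≗ X g
    ⊕-hom  : ∀ f g → X (f ⊕ g) ≗ X f ⊕ X g
    ⊛-hom  : ∀ c f → X (c ⊛ f) ≗ c ⊛ X f

  ⊖-hom : ∀ f g → X (f ⊖ g) ≗ X f ⊖ X g
  ⊖-hom f g n = begin
    X (f ⊖ g) n                  ≡⟨ cong-≗ (λ i → a-b≡a+-1*b (f i) (g i)) n ⟩
    X (f ⊕ -1ℤ ⊛ g) n            ≡⟨ ⊕-hom f (-1ℤ ⊛ g) n ⟩
    X f n ℤ.+ X (-1ℤ ⊛ g) n      ≡⟨ cong (ℤ._+_ (X f n)) (⊛-hom -1ℤ g n) ⟩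
    X f n ℤ.+ -1ℤ ℤ.* X g n      ≡⟨ a-b≡a+-1*b (X f n) (X g n) ⟨
    X f n ℤ.- X g n              ∎
    where
    open ≡-Reasoning
    a-b≡a+-1*b : ∀ a b → a ℤ.- b ≡ a ℤ.+ -1ℤ ℤ.* b
    a-b≡a+-1*b a b = cong (ℤ._+_ a) (sym (ℤₚ.-1*i≡-i b))

  zero-hom : X (λ _ → 0ℤ) ≗ (λ _ → 0ℤ)
  zero-hom n = begin
    X 0ˢ n          ≡⟨ cong-≗ {g = 0ℤ ⊛ 0ˢ} (λ _ → sym (ℤₚ.*-zeroˡ 0ℤ)) n ⟩
    X (0ℤ ⊛ 0ˢ) n   ≡⟨ ⊛-hom 0ℤ 0ˢ n ⟩
    0ℤ ℤ.* X 0ˢ n   ≡⟨ ℤₚ.*-zeroˡ (X 0ˢ n) ⟩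
    0ℤ              ∎
    where
    open ≡-Reasoning
    0ˢ : Seq
    0ˢ _ = 0ℤ

open Linear

id-linear : Linear (λ f → f)
id-linear = record { cong-≗ = λ f≗g → f≗g ; ⊕-hom = λ _ _ _ → refl ; ⊛-hom = λ _ _ _ → refl }

∘-linear : ∀ {X Y : Op} → Linear X → Linear Y → Linear (X ∘ Y)
∘-linear {X} {Y} LX LY = record
  { cong-≗ = λ f≗g → cong-≗ LX (cong-≗ LY f≗g)
  ; ⊕-hom  = λ f g n → trans (cong-≗ LX (⊕-hom LY f g) n) (⊕-hom LX (Y f) (Y g) n)
  ; ⊛-hom  = λ c f n → trans (cong-≗ LX (⊛-hom LY c f) n) (⊛-hom LX c (Y f) n)
  }

infixr 9 _^[_]_
_^[_]_ : Op → ℕ → Op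
X ^[ zero ]  f = f
X ^[ suc j ] f = X (X ^[ j ] f)

^[]-linear : ∀ {X : Op} → Linear X → ∀ j → Linear (X ^[ j ]_)
^[]-linear LX zero    = id-linear
^[]-linear LX (suc j) = ∘-linear LX (^[]-linear LX j)

^[]-+ : ∀ X i j f → X ^[ i + j ] f ≡ X ^[ i ] X ^[ j ] f
^[]-+ X zero    j f = refl
^[]-+ X (suc i) j f = cong X (^[]-+ X i j f)

^[]-* : ∀ X i j f → X ^[ i * j ] f ≡ (X ^[ j ]_) ^[ i ] f
^[]-* X zero    j f = refl
^[]-* X (suc i) j f = trans (^[]-+ X j (i * j) f) (cong (X ^[ j ]_) (^[]-* X i j f))

^[]-suc : ∀ X i f → X ^[ i ] X f ≡ X (X ^[ i ] f)
^[]-suc X zero    f = refl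
^[]-suc X (suc i) f = cong X (^[]-suc X i f)

^[]-comm : ∀ {X Y : Op} → Linear X → (∀ f → X (Y f) ≗ Y (X f)) → ∀ i f → X ^[ i ] Y f ≗ Y (X ^[ i ] f)
^[]-comm LX XY≗YX zero f n = refl
^[]-comm {X} {Y} LX XY≗YX (suc i) f n =
  trans (cong-≗ LX (^[]-comm {X} {Y} LX XY≗YX i f) n) (XY≗YX (X ^[ i ] f) n)

^[]-comm₂ : ∀ {X Y : Op} → Linear X → Linear Y → (∀ f → X (Y f) ≗ Y (X f)) →
            ∀ i j f → X ^[ i ] Y ^[ j ] f ≗ Y ^[ j ] X ^[ i ] f
^[]-comm₂ LX LY XY≗YX i j = ^[]-comm LX (λ g → sym ∘ ^[]-comm LY (λ h → sym ∘ XY≗YX h) j g) i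

Injective : Op → Set
Injective X = ∀ {f g} → X f ≗ X g → f ≗ g

^[]-injective : ∀ {X} → Injective X → ∀ j → Injective (X ^[ j ]_)
^[]-injective X-injective zero    = λ f≗g → f≗g
^[]-injective X-injective (suc j) = ^[]-injective X-injective j ∘ X-injective

Causal : Op → Set
Causal X = ∀ {f g} n → (∀ i → i ≤ n → f i ≡ g i) → X f n ≡ X g n

^[]-causal : ∀ {X : Op} → Causal X → ∀ j → Causal (X ^[ j ]_)
^[]-causal X-causal zero    n f≡g = f≡g n ≤-refl
^[]-causal X-causal (suc j) n f≡g =
  X-causal n (λ i i≤n → ^[]-causal X-causal j i (λ l l≤i → f≡g l (≤-trans l≤i i≤n)))

-- Congruences of sequences

infix 4 _≋_[mod_]
record _≋_[mod_] (f g : Seq) (m : ℤ) : Set where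
  constructor pointwise
  field at : ∀ n → m ∣ℤ f n ℤ.- g n
open _≋_[mod_]

∣ℤ0 : ∀ {m} → m ∣ℤ 0ℤ
∣ℤ0 {m} = divides 0ℤ (sym (ℤₚ.*-zeroˡ m))

≗⇒≋ : ∀ {m f g} → f ≗ g → f ≋ g [mod m ]
≗⇒≋ {m} f≗g = pointwise λ n → subst (m ∣ℤ_) (sym (ℤₚ.i≡j⇒i-j≡0 (f≗g n))) ∣ℤ0

≋-trans : ∀ {m f g h} → f ≋ g [mod m ] → g ≋ h [mod m ] → f ≋ h [mod m ]
≋-trans {m} {f} {g} {h} f≋g g≋h = pointwise λ n →
  subst (m ∣ℤ_) (ℤₚ.+-minus-telescope (f n) (g n) (h n)) (∣m∣n⇒∣m+n (at f≋g n) (at g≋h n))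

≋-respˡ : ∀ {m f g h} → f ≗ h → f ≋ g [mod m ] → h ≋ g [mod m ]
≋-respˡ {m} {g = g} f≗h f≋g = pointwise λ n → subst (λ z → m ∣ℤ z ℤ.- g n) (f≗h n) (at f≋g n)

≋-respʳ : ∀ {m f g h} → g ≗ h → f ≋ g [mod m ] → f ≋ h [mod m ]
≋-respʳ {m} {f} g≗h f≋g = pointwise λ n → subst (λ z → m ∣ℤ f n ℤ.- z) (g≗h n) (at f≋g n)

≋-preserved : ∀ {X : Op} → Linear X → ∀ {m f g} → f ≋ g [mod m ] → X f ≋ X g [mod m ]
≋-preserved {X} LX {m} {f} {g} f≋g = pointwise λ n → divides (X q n) (begin
  X f n ℤ.- X g n  ≡⟨ ⊖-hom LX f g n ⟨
  X (f ⊖ g) n      ≡⟨ cong-≗ LX f⊖g≗m⊛q n ⟩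
  X (m ⊛ q) n      ≡⟨ ⊛-hom LX m q n ⟩
  m ℤ.* X q n      ≡⟨ ℤₚ.*-comm m (X q n) ⟩
  X q n ℤ.* m      ∎)
  where
  open ≡-Reasoning
  q : Seq
  q i = _∣ℤ_.quotient (at f≋g i)
  f⊖g≗m⊛q : f ⊖ g ≗ m ⊛ q
  f⊖g≗m⊛q i = trans (_∣ℤ_.equality (at f≋g i)) (ℤₚ.*-comm (q i) m)

^[]-≋ : ∀ {X Y : Op} → Linear X → ∀ {m} → (∀ f → X f ≋ Y f [mod m ]) →
        ∀ j f → X ^[ j ] f ≋ Y ^[ j ] f [mod m ]
^[]-≋ LX X≋Y zero    f = ≗⇒≋ (λ _ → refl)
^[]-≋ LX X≋Y (suc j) f = ≋-trans (≋-preserved LX (^[]-≋ LX X≋Y j f)) (X≋Y _)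

module Lifting {X Y : Op} (LX : Linear X) (LY : Linear Y) (XY≗YX : ∀ f → X (Y f) ≗ Y (X f))
               (m : ℤ) (W : Op) (X≗Y+mW : ∀ f → X f ≗ Y f ⊕ m ⊛ W f) where

  expand : ∀ j f → X ^[ suc j ] f ≋ Y ^[ suc j ] f ⊕ (+ suc j ℤ.* m) ⊛ Y ^[ j ] W f [mod m ℤ.* m ]
  expand zero    f = ≗⇒≋ λ n →
    trans (X≗Y+mW f n) (cong (λ c → Y f n ℤ.+ c ℤ.* W f n) (sym (ℤₚ.*-identityˡ m)))
  expand (suc j) f = ≋-trans (≋-preserved LX (expand j f)) next-order
    where
    V : Seq
    V = Y ^[ suc j ] f
    Z : Seq
    Z = Y ^[ j ] W f
    c : ℤ
    c = + suc j ℤ.* m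
    XV≗YV+mYZ : X V ≗ Y V ⊕ m ⊛ Y Z
    XV≗YV+mYZ n = begin
      X V n                                                ≡⟨ ^[]-comm LY (λ g i → sym (XY≗YX g i)) (suc j) f n ⟨
      (Y ^[ suc j ] X f) n                                 ≡⟨ cong-≗ LYʲ (X≗Y+mW f) n ⟩
      (Y ^[ suc j ] (Y f ⊕ m ⊛ W f)) n                     ≡⟨ ⊕-hom LYʲ (Y f) (m ⊛ W f) n ⟩
      (Y ^[ suc j ] Y f) n ℤ.+ (Y ^[ suc j ] (m ⊛ W f)) n
        ≡⟨ cong₂ ℤ._+_ (cong (λ h → h n) (^[]-suc Y (suc j) f)) (⊛-hom LYʲ m (W f) n) ⟩
      Y V n ℤ.+ m ℤ.* Y Z n                                ∎
      where
      open ≡-Reasoning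
      LYʲ : Linear (Y ^[ suc j ]_)
      LYʲ = ^[]-linear LY (suc j)
    X[V⊕cZ] : X (V ⊕ c ⊛ Z) ≗ Y V ⊕ m ⊛ Y Z ⊕ c ⊛ (Y Z ⊕ m ⊛ W Z)
    X[V⊕cZ] n = trans (⊕-hom LX V (c ⊛ Z) n)
                      (cong₂ ℤ._+_ (XV≗YV+mYZ n) (trans (⊛-hom LX c Z n) (cong (ℤ._*_ c) (X≗Y+mW Z n))))
    next-order : X (V ⊕ c ⊛ Z) ≋ Y V ⊕ (+ suc (suc j) ℤ.* m) ⊛ Y Z [mod m ℤ.* m ]
    next-order = pointwise λ n → divides (+ suc j ℤ.* W Z n)
      (trans (cong (λ x → x ℤ.- (Y V n ℤ.+ (+ suc (suc j) ℤ.* m) ℤ.* Y Z n)) (X[V⊕cZ] n))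
             (collect m (Y V n) (Y Z n) (W Z n) (+ suc j)))
      where
      collect : ∀ m v y w s →
                v ℤ.+ m ℤ.* y ℤ.+ s ℤ.* m ℤ.* (y ℤ.+ m ℤ.* w) ℤ.- (v ℤ.+ (1ℤ ℤ.+ s) ℤ.* m ℤ.* y)
                ≡ s ℤ.* w ℤ.* (m ℤ.* m)
      collect = solve-∀

lift-exponent : ∀ {X Y : Op} → Linear X → Linear Y → (∀ f → X (Y f) ≗ Y (X f)) →
                ∀ p → (∀ f → X f ≋ Y f [mod + p ]) → ∀ f → X ^[ p ] f ≋ Y ^[ p ] f [mod + p ℤ.* + p ]
lift-exponent LX LY XY≗YX zero    X≋Y f = ≗⇒≋ (λ _ → refl)
-- With j + 1 = m, the correction term of expand j is a multiple of m².
lift-exponent {X} {Y} LX LY XY≗YX (suc p) X≋Y f =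
  ≋-trans (expand p f) (pointwise λ n → divides ((Y ^[ p ] W f) n) (cancel ((Y ^[ suc p ] f) n) _ m))
  where
  m : ℤ
  m = + suc p
  W : Op
  W g n = _∣ℤ_.quotient (at (X≋Y g) n)
  X≗Y+mW : ∀ g → X g ≗ Y g ⊕ m ⊛ W g
  X≗Y+mW g n = rearrange (X g n) (Y g n) (W g n) m (_∣ℤ_.equality (at (X≋Y g) n))
    where
    rearrange : ∀ x y w m → x ℤ.- y ≡ w ℤ.* m → x ≡ y ℤ.+ m ℤ.* w
    rearrange x y w m x-y≡wm = trans (x≡y+[x-y] x y) (cong (ℤ._+_ y) (trans x-y≡wm (ℤₚ.*-comm w m)))
      where
      x≡y+[x-y] : ∀ x y → x ≡ y ℤ.+ (x ℤ.- y)
      x≡y+[x-y] = solve-∀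
  open Lifting LX LY XY≗YX m W X≗Y+mW
  cancel : ∀ a z m → a ℤ.+ m ℤ.* m ℤ.* z ℤ.- a ≡ z ℤ.* (m ℤ.* m)
  cancel = solve-∀

-- Shifts, differences and dilation

shift : ℕ → Op
shift q f n with q ≤? n
... | yes _ = f (n ∸ q)
... | no  _ = 0ℤ

shift-≤ : ∀ {q n} f → q ≤ n → shift q f n ≡ f (n ∸ q)
shift-≤ {q} {n} f q≤n with q ≤? n
... | yes _   = refl
... | no  q≰n = ⊥-elim (q≰n q≤n)

shift-> : ∀ {q n} f → n < q → shift q f n ≡ 0ℤ
shift-> {q} {n} f n<q with q ≤? n
... | yes q≤n = ⊥-elim (<⇒≱ n<q q≤n)
... | no  _   = refl

shift-linear : ∀ q → Linear (shift q)
shift-linear q = record { cong-≗ = cong-≗′ ; ⊕-hom = ⊕-hom′ ; ⊛-hom = ⊛-hom′ }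
  where
  cong-≗′ : ∀ {f g} → f ≗ g → shift q f ≗ shift q g
  cong-≗′ f≗g n with q ≤? n
  ... | yes _ = f≗g (n ∸ q)
  ... | no  _ = refl
  ⊕-hom′ : ∀ f g → shift q (f ⊕ g) ≗ shift q f ⊕ shift q g
  ⊕-hom′ f g n with q ≤? n
  ... | yes _ = refl
  ... | no  _ = refl
  ⊛-hom′ : ∀ c f → shift q (c ⊛ f) ≗ c ⊛ shift q f
  ⊛-hom′ c f n with q ≤? n
  ... | yes _ = refl
  ... | no  _ = sym (ℤₚ.*-zeroʳ c)

shift-shift : ∀ a b f → shift a (shift b f) ≗ shift (a + b) f
shift-shift a b f n with a ≤? n | a + b ≤? n
... | yes a≤n | yes a+b≤n = trans (shift-≤ f (m+n≤o⇒m≤o∸n b (subst (_≤ n) (+-comm a b) a+b≤n)))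
                                  (cong f (∸-+-assoc n a b))
... | yes a≤n | no  a+b≰n = shift-> f (≰⇒> (a+b≰n ∘ a+b≤n))
  where
  a+b≤n : b ≤ n ∸ a → a + b ≤ n
  a+b≤n b≤n∸a = subst (_≤ n) (+-comm b a) (m≤o∸n⇒m+n≤o b a≤n b≤n∸a)
... | no  a≰n | yes a+b≤n = ⊥-elim (a≰n (m+n≤o⇒m≤o a a+b≤n))
... | no  _   | no  _     = refl

shift-comm : ∀ a b f → shift a (shift b f) ≗ shift b (shift a f)
shift-comm a b f n =
  trans (shift-shift a b f n) (trans (cong (λ c → shift c f n) (+-comm a b)) (sym (shift-shift b a f n)))

Δ : ℕ → Op
Δ q f = f ⊖ shift q f

Δ-linear : ∀ q → Linear (Δ q)
Δ-linear q = record
  { cong-≗ = λ f≗g n → cong₂ ℤ._-_ (f≗g n) (cong-≗ (shift-linear q) f≗g n)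
  ; ⊕-hom  = λ f g n → trans (cong (ℤ._-_ (f n ℤ.+ g n)) (⊕-hom (shift-linear q) f g n))
                             (regroup (f n) (g n) (shift q f n) (shift q g n))
  ; ⊛-hom  = λ c f n → trans (cong (ℤ._-_ (c ℤ.* f n)) (⊛-hom (shift-linear q) c f n))
                             (distrib c (f n) (shift q f n))
  }
  where
  regroup : ∀ a b c d → a ℤ.+ b ℤ.- (c ℤ.+ d) ≡ a ℤ.- c ℤ.+ (b ℤ.- d)
  regroup = solve-∀
  distrib : ∀ c a b → c ℤ.* a ℤ.- c ℤ.* b ≡ c ℤ.* (a ℤ.- b)
  distrib = solve-∀

Δ-comm : ∀ a b f → Δ a (Δ b f) ≗ Δ b (Δ a f)
Δ-comm a b f n = begin
  f n ℤ.- sb f n ℤ.- sa (Δ b f) n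
    ≡⟨ cong (ℤ._-_ (f n ℤ.- sb f n)) (⊖-hom (shift-linear a) f (sb f) n) ⟩
  f n ℤ.- sb f n ℤ.- (sa f n ℤ.- sa (sb f) n)
    ≡⟨ cong (λ z → f n ℤ.- sb f n ℤ.- (sa f n ℤ.- z)) (shift-comm a b f n) ⟩
  f n ℤ.- sb f n ℤ.- (sa f n ℤ.- sb (sa f) n)
    ≡⟨ swap (f n) (sb f n) (sa f n) (sb (sa f) n) ⟩
  f n ℤ.- sa f n ℤ.- (sb f n ℤ.- sb (sa f) n)
    ≡⟨ cong (ℤ._-_ (f n ℤ.- sa f n)) (⊖-hom (shift-linear b) f (sa f) n) ⟨
  f n ℤ.- sa f n ℤ.- sb (Δ a f) n ∎
  where
  open ≡-Reasoning
  sa : Op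
  sa = shift a
  sb : Op
  sb = shift b
  swap : ∀ x y z w → x ℤ.- y ℤ.- (z ℤ.- w) ≡ x ℤ.- z ℤ.- (y ℤ.- w)
  swap = solve-∀

Δ-injective : ∀ q .{{_ : NonZero q}} → Injective (Δ q)
Δ-injective q {f} {g} Δf≗Δg = <-rec (λ n → f n ≡ g n) step
  where
  step : ∀ n → (∀ {i} → i < n → f i ≡ g i) → f n ≡ g n
  step n earlier = begin
    f n                                  ≡⟨ x≡[x-y]+y (f n) (shift q f n) ⟩
    f n ℤ.- shift q f n ℤ.+ shift q f n  ≡⟨ cong₂ ℤ._+_ (Δf≗Δg n) shifts-agree ⟩
    g n ℤ.- shift q g n ℤ.+ shift q g n  ≡⟨ x≡[x-y]+y (g n) (shift q g n) ⟨
    g n                                  ∎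
    where
    open ≡-Reasoning
    x≡[x-y]+y : ∀ x y → x ≡ x ℤ.- y ℤ.+ y
    x≡[x-y]+y = solve-∀
    shifts-agree : shift q f n ≡ shift q g n
    shifts-agree with q ≤? n
    ... | yes q≤n = earlier (∸-monoʳ-< {n} (>-nonZero⁻¹ q) q≤n)
    ... | no  _   = refl

Δ-causal : ∀ q → Causal (Δ q)
Δ-causal q {f} {g} n f≡g = cong₂ ℤ._-_ (f≡g n ≤-refl) shifts-agree
  where
  shifts-agree : shift q f n ≡ shift q g n
  shifts-agree with q ≤? n
  ... | yes _ = f≡g (n ∸ q) (m∸n≤m n q)
  ... | no  _ = refl

dilate : ℕ → Op
dilate p f n with p ∣? n
... | yes (divides t _) = f t
... | no  _             = 0ℤ

dilate-* : ∀ p .{{_ : NonZero p}} f t → dilate p f (t * p) ≡ f t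
dilate-* p f t with p ∣? t * p
... | yes (divides t′ t*p≡t′*p) = cong f (*-cancelʳ-≡ t′ t p (sym t*p≡t′*p))
... | no  p∤t*p                 = ⊥-elim (p∤t*p (divides t refl))

dilate-∤ : ∀ {p n} f → ¬ p ∣ n → dilate p f n ≡ 0ℤ
dilate-∤ {p} {n} f p∤n with p ∣? n
... | yes p∣n = ⊥-elim (p∤n p∣n)
... | no  _   = refl

dilate-linear : ∀ p → Linear (dilate p)
dilate-linear p = record { cong-≗ = cong-≗′ ; ⊕-hom = ⊕-hom′ ; ⊛-hom = ⊛-hom′ }
  where
  cong-≗′ : ∀ {f g} → f ≗ g → dilate p f ≗ dilate p g
  cong-≗′ f≗g n with p ∣? n
  ... | yes (divides t _) = f≗g t
  ... | no  _             = refl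
  ⊕-hom′ : ∀ f g → dilate p (f ⊕ g) ≗ dilate p f ⊕ dilate p g
  ⊕-hom′ f g n with p ∣? n
  ... | yes _ = refl
  ... | no  _ = refl
  ⊛-hom′ : ∀ c f → dilate p (c ⊛ f) ≗ c ⊛ dilate p f
  ⊛-hom′ c f n with p ∣? n
  ... | yes _ = refl
  ... | no  _ = sym (ℤₚ.*-zeroʳ c)

dilate-causal : ∀ p .{{_ : NonZero p}} → Causal (dilate p)
dilate-causal p n f≡g with p ∣? n
... | yes (divides t refl) = f≡g t (m≤m*n t p)
... | no  _                = refl

Δ-dilate : ∀ p .{{_ : NonZero p}} q f → Δ (p * q) (dilate p f) ≗ dilate p (Δ q f)
Δ-dilate p q f n with p ∣? n
... | yes (divides t refl) = cong (ℤ._-_ (f t)) shifted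
  where
  shifted : shift (p * q) (dilate p f) (t * p) ≡ shift q f t
  shifted with q ≤? t
  ... | yes q≤t = begin
    shift (p * q) (dilate p f) (t * p)
      ≡⟨ shift-≤ (dilate p f) (subst (_≤ t * p) (*-comm q p) (*-monoˡ-≤ p q≤t)) ⟩
    dilate p f (t * p ∸ p * q)
      ≡⟨ cong (dilate p f) (trans (cong (t * p ∸_) (*-comm p q)) (sym (*-distribʳ-∸ p t q))) ⟩
    dilate p f ((t ∸ q) * p)
      ≡⟨ dilate-* p f (t ∸ q) ⟩
    f (t ∸ q) ∎
    where open ≡-Reasoning
  ... | no  q≰t = shift-> (dilate p f) (subst (t * p <_) (*-comm q p) (*-monoˡ-< p (≰⇒> q≰t)))
... | no  p∤n = cong (ℤ._-_ 0ℤ) shifted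
  where
  shifted : shift (p * q) (dilate p f) n ≡ 0ℤ
  shifted with p * q ≤? n
  ... | yes pq≤n = dilate-∤ f (λ p∣n∸pq → p∤n (∣m∸n∣n⇒∣m p pq≤n p∣n∸pq (divides q (*-comm p q))))
  ... | no  _    = refl

Δ^-dilate : ∀ p .{{_ : NonZero p}} q j f → Δ (p * q) ^[ j ] dilate p f ≗ dilate p (Δ q ^[ j ] f)
Δ^-dilate p q zero    f n = refl
Δ^-dilate p q (suc j) f n =
  trans (cong-≗ (Δ-linear (p * q)) (Δ^-dilate p q j f) n) (Δ-dilate p q (Δ q ^[ j ] f) n)

δ : Seq
δ zero    = 1ℤ
δ (suc n) = 0ℤ

dilate-δ : ∀ p .{{_ : NonZero p}} → dilate p δ ≗ δ
dilate-δ p zero = dilate-* p δ 0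
dilate-δ p (suc n) with p ∣? suc n
... | yes (divides (suc t) _) = refl
... | no  _                   = refl

-- Finite sums and the binomial expansion of (1 - x)ᵐ

∑ : ℕ → (ℕ → ℤ) → ℤ
∑ zero    a = 0ℤ
∑ (suc n) a = a 0 ℤ.+ ∑ n (λ i → a (suc i))

syntax ∑ n (λ i → x) = ∑[ i < n ] x

∑-cong : ∀ n {a b : ℕ → ℤ} → (∀ i → i < n → a i ≡ b i) → ∑ n a ≡ ∑ n b
∑-cong zero    a≡b = refl
∑-cong (suc n) a≡b = cong₂ ℤ._+_ (a≡b 0 (s≤s z≤n)) (∑-cong n (λ i i<n → a≡b (suc i) (s≤s i<n)))

∑-snoc : ∀ n (a : ℕ → ℤ) → ∑ (suc n) a ≡ ∑ n a ℤ.+ a n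
∑-snoc zero    a = trans (ℤₚ.+-identityʳ (a 0)) (sym (ℤₚ.+-identityˡ (a 0)))
∑-snoc (suc n) a = trans (cong (ℤ._+_ (a 0)) (∑-snoc n (λ i → a (suc i)))) (sym (ℤₚ.+-assoc (a 0) _ _))

∑-extend : ∀ {m n} (a : ℕ → ℤ) → m ≤ n → (∀ i → m ≤ i → a i ≡ 0ℤ) → ∑ n a ≡ ∑ m a
∑-extend {m} {zero}  a z≤n _ = refl
∑-extend {m} {suc n} a m≤1+n vanish with m≤n⇒m<n∨m≡n m≤1+n
... | inj₂ refl  = refl
... | inj₁ m<1+n = begin
  ∑ (suc n) a        ≡⟨ ∑-snoc n a ⟩
  ∑ n a ℤ.+ a n      ≡⟨ cong₂ ℤ._+_ (∑-extend a (≤-pred m<1+n) vanish) (vanish n (≤-pred m<1+n)) ⟩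
  ∑ m a ℤ.+ 0ℤ       ≡⟨ ℤₚ.+-identityʳ (∑ m a) ⟩
  ∑ m a              ∎
  where open ≡-Reasoning

∑-distrib-+ : ∀ n (a b : ℕ → ℤ) → ∑[ i < n ] (a i ℤ.+ b i) ≡ ∑ n a ℤ.+ ∑ n b
∑-distrib-+ zero    a b = refl
∑-distrib-+ (suc n) a b =
  trans (cong (ℤ._+_ (a 0 ℤ.+ b 0)) (∑-distrib-+ n (λ i → a (suc i)) (λ i → b (suc i)))) (regroup (a 0) (b 0) _ _)
  where
  regroup : ∀ x y u v → x ℤ.+ y ℤ.+ (u ℤ.+ v) ≡ x ℤ.+ u ℤ.+ (y ℤ.+ v)
  regroup = solve-∀

∑-distrib-- : ∀ n (a b : ℕ → ℤ) → ∑[ i < n ] (a i ℤ.- b i) ≡ ∑ n a ℤ.- ∑ n b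
∑-distrib-- zero    a b = refl
∑-distrib-- (suc n) a b =
  trans (cong (ℤ._+_ (a 0 ℤ.- b 0)) (∑-distrib-- n (λ i → a (suc i)) (λ i → b (suc i)))) (regroup (a 0) (b 0) _ _)
  where
  regroup : ∀ x y u v → x ℤ.- y ℤ.+ (u ℤ.- v) ≡ x ℤ.+ u ℤ.- (y ℤ.+ v)
  regroup = solve-∀

∑-∣ : ∀ {m} n (a : ℕ → ℤ) → (∀ i → i < n → m ∣ℤ a i) → m ∣ℤ ∑ n a
∑-∣ zero    a m∣a = ∣ℤ0
∑-∣ (suc n) a m∣a =
  ∣m∣n⇒∣m+n (m∣a 0 (s≤s z≤n)) (∑-∣ n (λ i → a (suc i)) (λ i i<n → m∣a (suc i) (s≤s i<n)))

∑-linear : ∀ {X : Op} → Linear X → ∀ B (c : ℕ → ℤ) (F : ℕ → Seq) →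
           X (λ n → ∑[ i < B ] (c i ℤ.* F i n)) ≗ (λ n → ∑[ i < B ] (c i ℤ.* X (F i) n))
∑-linear LX zero    c F = zero-hom LX
∑-linear {X} LX (suc B) c F n = begin
  X (c 0 ⊛ F 0 ⊕ rest) n                                     ≡⟨ ⊕-hom LX (c 0 ⊛ F 0) rest n ⟩
  X (c 0 ⊛ F 0) n ℤ.+ X rest n                               ≡⟨ cong₂ ℤ._+_ (⊛-hom LX (c 0) (F 0) n)
                                                                           (∑-linear LX B (c ∘ suc) (F ∘ suc) n) ⟩
  c 0 ℤ.* X (F 0) n ℤ.+ ∑[ i < B ] (c (suc i) ℤ.* X (F (suc i)) n) ∎
  where
  open ≡-Reasoning
  rest : Seq
  rest k = ∑[ i < B ] (c (suc i) ℤ.* F (suc i) k)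

binomial-step : ∀ m (a : ℕ → ℤ) →
  ∑[ i < suc (suc m) ] (-1ℤ ℤ.^ i ℤ.* + (suc m C i) ℤ.* a i) ≡
  ∑[ i < suc m ] (-1ℤ ℤ.^ i ℤ.* + (m C i) ℤ.* a i) ℤ.-
  ∑[ i < suc m ] (-1ℤ ℤ.^ i ℤ.* + (m C i) ℤ.* a (suc i))
binomial-step m a = begin
  b 0 ℤ.+ ∑[ i < suc m ] (-1ℤ ℤ.^ suc i ℤ.* + (suc m C suc i) ℤ.* a (suc i))
    ≡⟨ cong (ℤ._+_ (b 0)) (∑-cong (suc m) (λ i _ → pascal i)) ⟩
  b 0 ℤ.+ ∑[ i < suc m ] (b (suc i) ℤ.- t i)
    ≡⟨ cong (ℤ._+_ (b 0)) (∑-distrib-- (suc m) (b ∘ suc) t) ⟩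
  b 0 ℤ.+ (∑[ i < suc m ] b (suc i) ℤ.- ∑ (suc m) t)
    ≡⟨ ℤₚ.+-assoc (b 0) _ _ ⟨
  ∑ (suc (suc m)) b ℤ.- ∑ (suc m) t
    ≡⟨ cong (ℤ._- ∑ (suc m) t) (∑-snoc (suc m) b) ⟩
  ∑ (suc m) b ℤ.+ b (suc m) ℤ.- ∑ (suc m) t
    ≡⟨ cong (λ z → ∑ (suc m) b ℤ.+ z ℤ.- ∑ (suc m) t) last-vanishes ⟩
  ∑ (suc m) b ℤ.+ 0ℤ ℤ.- ∑ (suc m) t
    ≡⟨ cong (ℤ._- ∑ (suc m) t) (ℤₚ.+-identityʳ (∑ (suc m) b)) ⟩
  ∑ (suc m) b ℤ.- ∑ (suc m) t ∎
  where
  open ≡-Reasoning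
  b t : ℕ → ℤ
  b i = -1ℤ ℤ.^ i ℤ.* + (m C i) ℤ.* a i
  t i = -1ℤ ℤ.^ i ℤ.* + (m C i) ℤ.* a (suc i)
  pascal : ∀ i → -1ℤ ℤ.^ suc i ℤ.* + (suc m C suc i) ℤ.* a (suc i) ≡ b (suc i) ℤ.- t i
  pascal i = begin
    -1ℤ ℤ.^ suc i ℤ.* + (suc m C suc i) ℤ.* a (suc i)
      ≡⟨ cong (λ c → -1ℤ ℤ.^ suc i ℤ.* + c ℤ.* a (suc i)) (nCk+nC[k+1]≡[n+1]C[k+1] m i) ⟨
    -1ℤ ℤ.^ suc i ℤ.* + (m C i + m C suc i) ℤ.* a (suc i)
      ≡⟨ cong (λ c → -1ℤ ℤ.^ suc i ℤ.* c ℤ.* a (suc i)) (ℤₚ.pos-+ (m C i) (m C suc i)) ⟩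
    -1ℤ ℤ.* s ℤ.* (+ (m C i) ℤ.+ + (m C suc i)) ℤ.* a (suc i)
      ≡⟨ split s (+ (m C i)) (+ (m C suc i)) (a (suc i)) ⟩
    b (suc i) ℤ.- t i ∎
    where
    s : ℤ
    s = -1ℤ ℤ.^ i
    split : ∀ s x y z → -1ℤ ℤ.* s ℤ.* (x ℤ.+ y) ℤ.* z ≡ -1ℤ ℤ.* s ℤ.* y ℤ.* z ℤ.- s ℤ.* x ℤ.* z
    split = solve-∀
  last-vanishes : b (suc m) ≡ 0ℤ
  last-vanishes = begin
    -1ℤ ℤ.^ suc m ℤ.* + (m C suc m) ℤ.* a (suc m)
      ≡⟨ cong (λ c → -1ℤ ℤ.^ suc m ℤ.* + c ℤ.* a (suc m)) (k>n⇒nCk≡0 (n<1+n m)) ⟩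
    -1ℤ ℤ.^ suc m ℤ.* 0ℤ ℤ.* a (suc m)
      ≡⟨ cong (ℤ._* a (suc m)) (ℤₚ.*-zeroʳ (-1ℤ ℤ.^ suc m)) ⟩
    0ℤ ℤ.* a (suc m)
      ≡⟨ ℤₚ.*-zeroˡ (a (suc m)) ⟩
    0ℤ ∎

Δ¹^-binomial : ∀ m f n → (Δ 1 ^[ m ] f) n ≡ ∑[ i < suc m ] (-1ℤ ℤ.^ i ℤ.* + (m C i) ℤ.* shift i f n)
Δ¹^-binomial zero    f n = sym (trans (ℤₚ.+-identityʳ _) (ℤₚ.*-identityˡ (f n)))
Δ¹^-binomial (suc m) f n = begin
  Δ 1 (Δ 1 ^[ m ] f) n
    ≡⟨ cong-≗ (Δ-linear 1) (Δ¹^-binomial m f) n ⟩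
  E n ℤ.- shift 1 E n
    ≡⟨ cong (ℤ._-_ (E n)) (∑-linear (shift-linear 1) (suc m) c (λ i → shift i f) n) ⟩
  E n ℤ.- ∑[ i < suc m ] (c i ℤ.* shift 1 (shift i f) n)
    ≡⟨ cong (ℤ._-_ (E n)) (∑-cong (suc m) (λ i _ → cong (ℤ._*_ (c i)) (shift-shift 1 i f n))) ⟩
  E n ℤ.- ∑[ i < suc m ] (c i ℤ.* shift (suc i) f n)
    ≡⟨ binomial-step m (λ i → shift i f n) ⟨
  ∑[ i < suc (suc m) ] (-1ℤ ℤ.^ i ℤ.* + (suc m C i) ℤ.* shift i f n) ∎
  where
  open ≡-Reasoning
  c : ℕ → ℤ
  c i = -1ℤ ℤ.^ i ℤ.* + (m C i)
  E : Seq
  E k = ∑[ i < suc m ] (c i ℤ.* shift i f k)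

[k+1]*[n+1]C[k+1]≡[n+1]*nCk : ∀ n k → suc k * (suc n C suc k) ≡ suc n * (n C k)
[k+1]*[n+1]C[k+1]≡[n+1]*nCk zero    zero    = refl
[k+1]*[n+1]C[k+1]≡[n+1]*nCk zero    (suc k)
  rewrite k>n⇒nCk≡0 {1} {suc (suc k)} (s≤s (s≤s z≤n)) | k>n⇒nCk≡0 {0} {suc k} (s≤s z≤n)
  = *-zeroʳ (suc (suc k))
[k+1]*[n+1]C[k+1]≡[n+1]*nCk (suc n) zero    = trans (*-identityˡ _) (trans (nC1≡n (suc (suc n))) (sym (*-identityʳ _)))
[k+1]*[n+1]C[k+1]≡[n+1]*nCk (suc n) (suc k) = begin
  suc (suc k) * (suc (suc n) C suc (suc k))    ≡⟨ cong (suc (suc k) *_) (nCk+nC[k+1]≡[n+1]C[k+1] (suc n) (suc k)) ⟨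
  suc (suc k) * (x + y)                        ≡⟨ regroup k x y ⟩
  x + suc k * x + suc (suc k) * y              ≡⟨ cong₂ (λ u v → x + u + v) ([k+1]*[n+1]C[k+1]≡[n+1]*nCk n k)
                                                                          ([k+1]*[n+1]C[k+1]≡[n+1]*nCk n (suc k)) ⟩
  x + suc n * (n C k) + suc n * (n C suc k)    ≡⟨ +-assoc x _ _ ⟩
  x + (suc n * (n C k) + suc n * (n C suc k))  ≡⟨ cong (_+_ x) (*-distribˡ-+ (suc n) (n C k) (n C suc k)) ⟨
  x + suc n * (n C k + n C suc k)              ≡⟨ cong (λ z → x + suc n * z) (nCk+nC[k+1]≡[n+1]C[k+1] n k) ⟩
  x + suc n * x                                ∎
  where
  open ≡-Reasoning
  x : ℕ
  x = suc n C suc k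
  y : ℕ
  y = suc n C suc (suc k)
  regroup : ∀ k x y → suc (suc k) * (x + y) ≡ x + suc k * x + suc (suc k) * y
  regroup = ℕ-Solver.solve-∀

prime∣pCk : ∀ {p k} → Prime p → 0 < k → k < p → p ∣ p C k
prime∣pCk {suc n} {suc i} p-prime _ k<p
  with euclidsLemma (suc i) (suc n C suc i) p-prime
         (divides (n C i) (trans ([k+1]*[n+1]C[k+1]≡[n+1]*nCk n i) (*-comm (suc n) (n C i))))
... | inj₁ p∣k = ⊥-elim (<⇒≱ k<p (∣⇒≤ p∣k))
... | inj₂ p∣C = p∣C

odd-prime : ∀ {p} → Prime p → p ≢ 2 → ¬ 2 ∣ p
odd-prime {p} p-prime p≢2 2∣p =
  Prime.notComposite p-prime (composite-≢ 2 {{_}} {{prime⇒nonZero p-prime}} (p≢2 ∘ sym) 2∣p)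

-1^odd≡-1 : ∀ n → ¬ 2 ∣ n → -1ℤ ℤ.^ n ≡ -1ℤ
-1^odd≡-1 zero          2∤0   = ⊥-elim (2∤0 (divides 0 refl))
-1^odd≡-1 (suc zero)    _     = refl
-1^odd≡-1 (suc (suc n)) 2∤2+n = trans (-1*-1*x≡x (-1ℤ ℤ.^ n)) (-1^odd≡-1 n 2∤n)
  where
  2∤n : ¬ 2 ∣ n
  2∤n (divides q n≡q*2) = 2∤2+n (divides (suc q) (cong (suc ∘ suc) n≡q*2))
  -1*-1*x≡x : ∀ x → -1ℤ ℤ.* (-1ℤ ℤ.* x) ≡ x
  -1*-1*x≡x = solve-∀

frobenius : ∀ {p} → Prime p → ¬ 2 ∣ p → ∀ f → Δ 1 ^[ p ] f ≋ Δ p f [mod + p ]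
frobenius {suc q} p-prime p-odd f = pointwise λ n →
  subst (+ p ∣ℤ_) (sym (difference n)) (∑-∣ q (λ i → term (suc i) n) (λ i i<q → inner-∣ i i<q n))
  where
  p : ℕ
  p = suc q
  term : ℕ → Seq
  term i n = -1ℤ ℤ.^ i ℤ.* + (p C i) ℤ.* shift i f n
  inner-∣ : ∀ i → i < q → ∀ n → + p ∣ℤ term (suc i) n
  inner-∣ i i<q n =
    ∣m⇒∣m*n (shift (suc i) f n)
            (∣n⇒∣m*n (-1ℤ ℤ.^ suc i) (∣ᵤ⇒∣ (prime∣pCk p-prime (s≤s z≤n) (s≤s i<q))))
  last-term : ∀ n → term p n ≡ ℤ.- shift p f n
  last-term n = begin
    -1ℤ ℤ.^ p ℤ.* + (p C p) ℤ.* shift p f n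
      ≡⟨ cong₂ (λ s c → s ℤ.* + c ℤ.* shift p f n) (-1^odd≡-1 p p-odd) (nCn≡1 p) ⟩
    -1ℤ ℤ.* 1ℤ ℤ.* shift p f n
      ≡⟨ -1*1*x≡-x (shift p f n) ⟩
    ℤ.- shift p f n ∎
    where
    open ≡-Reasoning
    -1*1*x≡-x : ∀ x → -1ℤ ℤ.* 1ℤ ℤ.* x ≡ ℤ.- x
    -1*1*x≡-x = solve-∀
  difference : ∀ n → (Δ 1 ^[ p ] f) n ℤ.- Δ p f n ≡ ∑[ i < q ] term (suc i) n
  difference n = begin
    (Δ 1 ^[ p ] f) n ℤ.- Δ p f n
      ≡⟨ cong (ℤ._- Δ p f n) (Δ¹^-binomial p f n) ⟩
    term 0 n ℤ.+ ∑[ i < p ] term (suc i) n ℤ.- Δ p f n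
      ≡⟨ cong (λ z → term 0 n ℤ.+ z ℤ.- Δ p f n) (∑-snoc q (λ i → term (suc i) n)) ⟩
    term 0 n ℤ.+ (∑[ i < q ] term (suc i) n ℤ.+ term p n) ℤ.- Δ p f n
      ≡⟨ cong (λ z → term 0 n ℤ.+ (∑[ i < q ] term (suc i) n ℤ.+ z) ℤ.- Δ p f n) (last-term n) ⟩
    1ℤ ℤ.* 1ℤ ℤ.* f n ℤ.+ (∑[ i < q ] term (suc i) n ℤ.+ ℤ.- shift p f n) ℤ.- (f n ℤ.- shift p f n)
      ≡⟨ cancel (f n) (∑[ i < q ] term (suc i) n) (shift p f n) ⟩
    ∑[ i < q ] term (suc i) n ∎
    where
    open ≡-Reasoning
    cancel : ∀ x s y → 1ℤ ℤ.* 1ℤ ℤ.* x ℤ.+ (s ℤ.+ ℤ.- y) ℤ.- (x ℤ.- y) ≡ s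
    cancel = solve-∀

-- The coefficients and their functional equation

-- Δ⁻ q m g is g divided by (1 - x^q)^(m+1), read off from (1 - y)^-(m+1) = Σⱼ C(j+m, m) yʲ;
-- the j-th summand vanishes for j > n, as q * j > n once q ≠ 0.
Δ⁻ : ℕ → ℕ → Op
Δ⁻ q m g n = ∑[ j < suc n ] (+ ((j + m) C m) ℤ.* shift (q * j) g n)

Δ⁻-head : ∀ q m g n → + ((0 + m) C m) ℤ.* shift (q * 0) g n ≡ g n
Δ⁻-head q m g n = begin
  + (m C m) ℤ.* shift (q * 0) g n   ≡⟨ cong₂ (λ c s → + c ℤ.* shift s g n) (nCn≡1 m) (*-zeroʳ q) ⟩
  1ℤ ℤ.* g n                        ≡⟨ ℤₚ.*-identityˡ (g n) ⟩
  g n                               ∎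
  where open ≡-Reasoning

Δ⁻-below : ∀ q .{{_ : NonZero q}} m g n → n < q → Δ⁻ q m g n ≡ g n
Δ⁻-below q m g n n<q = begin
  Δ⁻ q m g n                                     ≡⟨ ∑-extend _ (s≤s (z≤n {n})) vanish ⟩
  + ((0 + m) C m) ℤ.* shift (q * 0) g n ℤ.+ 0ℤ   ≡⟨ ℤₚ.+-identityʳ _ ⟩
  + ((0 + m) C m) ℤ.* shift (q * 0) g n          ≡⟨ Δ⁻-head q m g n ⟩
  g n                                            ∎
  where
  open ≡-Reasoning
  vanish : ∀ j → 1 ≤ j → + ((j + m) C m) ℤ.* shift (q * j) g n ≡ 0ℤ
  vanish (suc j) _ = trans (cong (ℤ._*_ (+ ((suc j + m) C m))) (shift-> g (<-≤-trans n<q (m≤m*n q (suc j)))))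
                           (ℤₚ.*-zeroʳ (+ ((suc j + m) C m)))

shift-Δ⁻ : ∀ q .{{_ : NonZero q}} m g n →
           shift q (Δ⁻ q m g) n ≡ ∑[ j < n ] (+ ((j + m) C m) ℤ.* shift (q * suc j) g n)
shift-Δ⁻ q m g n with q ≤? n
... | no q≰n = sym (∑-extend _ (z≤n {n}) (λ j _ → vanish j))
  where
  vanish : ∀ j → + ((j + m) C m) ℤ.* shift (q * suc j) g n ≡ 0ℤ
  vanish j = trans (cong (ℤ._*_ (+ ((j + m) C m))) (shift-> g (<-≤-trans (≰⇒> q≰n) (m≤m*n q (suc j)))))
                   (ℤₚ.*-zeroʳ (+ ((j + m) C m)))
... | yes q≤n = begin
  ∑[ j < suc (n ∸ q) ] (c j ℤ.* shift (q * j) g (n ∸ q))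
    ≡⟨ ∑-extend _ n∸q<n vanish ⟨
  ∑[ j < n ] (c j ℤ.* shift (q * j) g (n ∸ q))
    ≡⟨ ∑-cong n (λ j _ → cong (ℤ._*_ (c j)) (shift-step j)) ⟩
  ∑[ j < n ] (c j ℤ.* shift (q * suc j) g n) ∎
  where
  open ≡-Reasoning
  c : ℕ → ℤ
  c j = + ((j + m) C m)
  n∸q<n : n ∸ q < n
  n∸q<n = ∸-monoʳ-< {n} (>-nonZero⁻¹ q) q≤n
  vanish : ∀ j → suc (n ∸ q) ≤ j → c j ℤ.* shift (q * j) g (n ∸ q) ≡ 0ℤ
  vanish j n∸q<j = trans (cong (ℤ._*_ (c j)) (shift-> g (<-≤-trans n∸q<j (m≤n*m j q)))) (ℤₚ.*-zeroʳ (c j))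
  shift-step : ∀ j → shift (q * j) g (n ∸ q) ≡ shift (q * suc j) g n
  shift-step j = begin
    shift (q * j) g (n ∸ q)       ≡⟨ shift-≤ (shift (q * j) g) q≤n ⟨
    shift q (shift (q * j) g) n   ≡⟨ shift-shift q (q * j) g n ⟩
    shift (q + q * j) g n         ≡⟨ cong (λ s → shift s g n) (*-suc q j) ⟨
    shift (q * suc j) g n         ∎

Δ⁻-zero-unfold : ∀ q .{{_ : NonZero q}} g n → Δ⁻ q 0 g n ≡ g n ℤ.+ shift q (Δ⁻ q 0 g) n
Δ⁻-zero-unfold q g n = cong₂ ℤ._+_ (Δ⁻-head q 0 g n) (sym (shift-Δ⁻ q 0 g n))

Δ⁻-suc-unfold : ∀ q .{{_ : NonZero q}} m g n → Δ⁻ q (suc m) g n ≡ Δ⁻ q m g n ℤ.+ shift q (Δ⁻ q (suc m) g) n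
Δ⁻-suc-unfold q m g n = begin
  head (suc m) ℤ.+ ∑[ j < n ] (+ ((suc j + suc m) C suc m) ℤ.* s j)
    ≡⟨ cong (ℤ._+_ (head (suc m))) (∑-cong n (λ j _ → pascal j)) ⟩
  head (suc m) ℤ.+ ∑[ j < n ] (+ ((suc j + m) C m) ℤ.* s j ℤ.+ + ((j + suc m) C suc m) ℤ.* s j)
    ≡⟨ cong (ℤ._+_ (head (suc m))) (∑-distrib-+ n _ _) ⟩
  head (suc m) ℤ.+ (∑[ j < n ] (+ ((suc j + m) C m) ℤ.* s j) ℤ.+ ∑[ j < n ] (+ ((j + suc m) C suc m) ℤ.* s j))
    ≡⟨ ℤₚ.+-assoc (head (suc m)) _ _ ⟨
  head (suc m) ℤ.+ ∑[ j < n ] (+ ((suc j + m) C m) ℤ.* s j) ℤ.+ ∑[ j < n ] (+ ((j + suc m) C suc m) ℤ.* s j)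
    ≡⟨ cong₂ (λ h r → h ℤ.+ ∑[ j < n ] (+ ((suc j + m) C m) ℤ.* s j) ℤ.+ r)
             (trans (Δ⁻-head q (suc m) g n) (sym (Δ⁻-head q m g n))) (sym (shift-Δ⁻ q (suc m) g n)) ⟩
  Δ⁻ q m g n ℤ.+ shift q (Δ⁻ q (suc m) g) n ∎
  where
  open ≡-Reasoning
  head : ℕ → ℤ
  head m = + ((0 + m) C m) ℤ.* shift (q * 0) g n
  s : ℕ → ℤ
  s j = shift (q * suc j) g n
  pascal : ∀ j → + ((suc j + suc m) C suc m) ℤ.* s j
                  ≡ + ((suc j + m) C m) ℤ.* s j ℤ.+ + ((j + suc m) C suc m) ℤ.* s j
  pascal j = begin
    + ((suc j + suc m) C suc m) ℤ.* s j
      ≡⟨ cong (λ c → + c ℤ.* s j) (nCk+nC[k+1]≡[n+1]C[k+1] (j + suc m) m) ⟨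
    + ((j + suc m) C m + (j + suc m) C suc m) ℤ.* s j
      ≡⟨ cong (λ i → + (i C m + (j + suc m) C suc m) ℤ.* s j) (+-suc j m) ⟩
    + ((suc j + m) C m + (j + suc m) C suc m) ℤ.* s j
      ≡⟨ ℤₚ.*-distribʳ-+ (s j) (+ ((suc j + m) C m)) (+ ((j + suc m) C suc m)) ⟩
    + ((suc j + m) C m) ℤ.* s j ℤ.+ + ((j + suc m) C suc m) ℤ.* s j ∎

x≡y+s⇒x-s≡y : ∀ {x y s} → x ≡ y ℤ.+ s → x ℤ.- s ≡ y
x≡y+s⇒x-s≡y {y = y} {s} refl = [y+s]-s≡y y s
  where
  [y+s]-s≡y : ∀ y s → y ℤ.+ s ℤ.- s ≡ y
  [y+s]-s≡y = solve-∀

Δ^Δ⁻ : ∀ q .{{_ : NonZero q}} m g → Δ q ^[ suc m ] Δ⁻ q m g ≗ g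
Δ^Δ⁻ q zero    g n = x≡y+s⇒x-s≡y (Δ⁻-zero-unfold q g n)
Δ^Δ⁻ q (suc m) g n = begin
  Δ q (Δ q ^[ suc m ] Δ⁻ q (suc m) g) n     ≡⟨ cong (λ h → h n) (^[]-suc (Δ q) (suc m) (Δ⁻ q (suc m) g)) ⟨
  (Δ q ^[ suc m ] Δ q (Δ⁻ q (suc m) g)) n   ≡⟨ cong-≗ (^[]-linear (Δ-linear q) (suc m)) Δ-Δ⁻ n ⟩
  (Δ q ^[ suc m ] Δ⁻ q m g) n               ≡⟨ Δ^Δ⁻ q m g n ⟩
  g n                                       ∎
  where
  open ≡-Reasoning
  Δ-Δ⁻ : Δ q (Δ⁻ q (suc m) g) ≗ Δ⁻ q m g
  Δ-Δ⁻ n = x≡y+s⇒x-s≡y (Δ⁻-suc-unfold q m g n)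

coeffℤ : ℕ → ℕ → ℕ → Seq
coeffℤ p k M n = + coeff p k M n

Aℤ : ℕ → ℕ → Seq
Aℤ p k n = + A p k n

+sum-map-applyUpTo : ∀ (t f : ℕ → ℕ) N → + sum (map t (applyUpTo f N)) ≡ ∑[ j < N ] (+ t (f j))
+sum-map-applyUpTo t f zero    = refl
+sum-map-applyUpTo t f (suc N) =
  trans (ℤₚ.pos-+ (t (f 0)) _) (cong (ℤ._+_ (+ t (f 0))) (+sum-map-applyUpTo t (f ∘ suc) N))

-- The summand in the definition of coeff is local to Defs; unification names it.
coeff-summand : ∀ p k M n → Σ (ℕ → ℕ) λ t → coeff p k (suc M) n ≡ sum (map t (upTo (suc n)))
coeff-summand p k M n = _ , refl

coeff-summand-≡ : ∀ p m M n j →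
  + proj₁ (coeff-summand p (suc m) M n) j ≡ + ((j + m) C m) ℤ.* shift (p ^ M * j) (coeffℤ p (suc m) M) n
coeff-summand-≡ p m M n j with p ^ M * j ≤? n
... | yes _ rewrite +-suc j m = ℤₚ.pos-* ((j + m) C m) (coeff p (suc m) M (n ∸ p ^ M * j))
... | no  _                   = sym (ℤₚ.*-zeroʳ (+ ((j + m) C m)))

coeff-suc : ∀ p m M → coeffℤ p (suc m) (suc M) ≗ Δ⁻ (p ^ M) m (coeffℤ p (suc m) M)
coeff-suc p m M n = begin
  + coeff p (suc m) (suc M) n          ≡⟨ cong +_ (proj₂ (coeff-summand p (suc m) M n)) ⟩
  + sum (map t (upTo (suc n)))         ≡⟨ +sum-map-applyUpTo t (λ j → j) (suc n) ⟩
  ∑[ j < suc n ] (+ t j)               ≡⟨ ∑-cong (suc n) (λ j _ → coeff-summand-≡ p m M n j) ⟩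
  Δ⁻ (p ^ M) m (coeffℤ p (suc m) M) n  ∎
  where
  open ≡-Reasoning
  t : ℕ → ℕ
  t = proj₁ (coeff-summand p (suc m) M n)

coeff-zero : ∀ p k → coeffℤ p k 0 ≗ δ
coeff-zero p k zero    = refl
coeff-zero p k (suc n) = refl

coeff-Δ : ∀ p .{{_ : NonZero p}} m M → Δ (p ^ M) ^[ suc m ] coeffℤ p (suc m) (suc M) ≗ coeffℤ p (suc m) M
coeff-Δ p m M n =
  trans (cong-≗ (^[]-linear (Δ-linear (p ^ M)) (suc m)) (coeff-suc p m M) n) (Δ^Δ⁻ (p ^ M) {{m^n≢0 p M}} m _ n)

coeff-functional : ∀ p .{{_ : NonZero p}} m M →
                   Δ 1 ^[ suc m ] coeffℤ p (suc m) (suc M) ≗ dilate p (coeffℤ p (suc m) M)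
coeff-functional p m zero    n = begin
  (Δ 1 ^[ suc m ] coeffℤ p (suc m) 1) n   ≡⟨ coeff-Δ p m 0 n ⟩
  coeffℤ p (suc m) 0 n                    ≡⟨ coeff-zero p (suc m) n ⟩
  δ n                                     ≡⟨ dilate-δ p n ⟨
  dilate p δ n                            ≡⟨ cong-≗ (dilate-linear p) (coeff-zero p (suc m)) n ⟨
  dilate p (coeffℤ p (suc m) 0) n         ∎
  where open ≡-Reasoning
coeff-functional p m (suc M) = ^[]-injective (Δ-injective q {{m^n≢0 p (suc M)}}) k (λ n → trans (lhs n) (sym (rhs n)))
  where
  k : ℕ
  k = suc m
  q : ℕ
  q = p ^ suc M
  lhs : Δ q ^[ k ] Δ 1 ^[ k ] coeffℤ p k (suc (suc M)) ≗ dilate p (coeffℤ p k M)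
  lhs n = begin
    (Δ q ^[ k ] Δ 1 ^[ k ] coeffℤ p k (suc (suc M))) n
      ≡⟨ ^[]-comm₂ (Δ-linear q) (Δ-linear 1) (Δ-comm q 1) k k _ n ⟩
    (Δ 1 ^[ k ] Δ q ^[ k ] coeffℤ p k (suc (suc M))) n
      ≡⟨ cong-≗ (^[]-linear (Δ-linear 1) k) (coeff-Δ p m (suc M)) n ⟩
    (Δ 1 ^[ k ] coeffℤ p k (suc M)) n
      ≡⟨ coeff-functional p m M n ⟩
    dilate p (coeffℤ p k M) n ∎
    where open ≡-Reasoning
  rhs : Δ q ^[ k ] dilate p (coeffℤ p k (suc M)) ≗ dilate p (coeffℤ p k M)
  rhs n = trans (Δ^-dilate p (p ^ M) k _ n) (cong-≗ (dilate-linear p) (coeff-Δ p m M) n)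

n<m^n : ∀ {m} → 1 < m → ∀ n → n < m ^ n
n<m^n {m} 1<m zero    = s≤s z≤n
n<m^n {m} 1<m (suc n) = begin-strict
  suc n          ≤⟨ n<m^n 1<m n ⟩
  m ^ n          <⟨ m<m+n (m ^ n) (≤-trans (s≤s z≤n) (n<m^n 1<m n)) ⟩
  m ^ n + m ^ n  ≡⟨ cong (_+_ (m ^ n)) (+-identityʳ (m ^ n)) ⟨
  2 * m ^ n      ≤⟨ *-monoˡ-≤ (m ^ n) 1<m ⟩
  m * m ^ n      ∎
  where open ≤-Reasoning

module _ (p : ℕ) .{{_ : NonTrivial p}} (m : ℕ) where

  private
    k : ℕ
    k = suc m
    instance
      p-nonZero : NonZero p
      p-nonZero = nonTrivial⇒nonZero p

  coeff≡A : ∀ M n → n < M → coeffℤ p k M n ≡ Aℤ p k n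
  coeff≡A (suc M) n n<1+M with m≤n⇒m<n∨m≡n (≤-pred n<1+M)
  ... | inj₂ refl = refl
  ... | inj₁ n<M  = begin
    coeffℤ p k (suc M) n
      ≡⟨ coeff-suc p m M n ⟩
    Δ⁻ (p ^ M) m (coeffℤ p k M) n
      ≡⟨ Δ⁻-below (p ^ M) {{m^n≢0 p M}} m _ n (<-trans n<M (n<m^n (nonTrivial⇒n>1 p) M)) ⟩
    coeffℤ p k M n
      ≡⟨ coeff≡A M n n<M ⟩
    Aℤ p k n ∎
    where open ≡-Reasoning

  A-functional : Δ 1 ^[ k ] Aℤ p k ≗ dilate p (Aℤ p k)
  A-functional n = begin
    (Δ 1 ^[ k ] Aℤ p k) n
      ≡⟨ ^[]-causal (Δ-causal 1) k n (λ i i≤n → sym (coeff≡A (2 + n) i (s≤s (m≤n⇒m≤1+n i≤n)))) ⟩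
    (Δ 1 ^[ k ] coeffℤ p k (2 + n)) n
      ≡⟨ coeff-functional p m (suc n) n ⟩
    dilate p (coeffℤ p k (suc n)) n
      ≡⟨ dilate-causal p n (λ i i≤n → coeff≡A (suc n) i (s≤s i≤n)) ⟩
    dilate p (Aℤ p k) n ∎
    where open ≡-Reasoning

  A-zero : A p k 0 ≡ 1
  A-zero = trans (+-identityʳ _) (trans (*-identityʳ _) (nCn≡1 m))

-- Divisibility of the coefficients of (1 - x)ʲ g

Δ¹^-∣-beyond : ∀ {m g d} → (∀ i → d < i → m ∣ℤ g i) → ∀ j i → d + j < i → m ∣ℤ (Δ 1 ^[ j ] g) i
Δ¹^-∣-beyond {d = d} g∣ zero i d+0<i = g∣ i (subst (_< i) (+-identityʳ d) d+0<i)
Δ¹^-∣-beyond {m} {g} {d} g∣ (suc j) (suc i) d+1+j<1+i =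
  ∣m∣n⇒∣m-n (Δ¹^-∣-beyond g∣ j (suc i) (<-trans d+j<i (n<1+n i)))
            (subst (m ∣ℤ_) (sym (shift-≤ (Δ 1 ^[ j ] g) (s≤s z≤n))) (Δ¹^-∣-beyond g∣ j i d+j<i))
  where
  d+j<i : d + j < i
  d+j<i = ≤-pred (subst (_< suc i) (+-suc d j) d+1+j<1+i)

Δ¹^-∤-at : ∀ {m g d} → ¬ m ∣ℤ g d → (∀ i → d < i → m ∣ℤ g i) →
           ∀ j → ¬ m ∣ℤ (Δ 1 ^[ j ] g) (d + j)
Δ¹^-∤-at {m} {g} {d} m∤gd g∣ zero = subst (λ i → ¬ m ∣ℤ g i) (sym (+-identityʳ d)) m∤gd
Δ¹^-∤-at {m} {g} {d} m∤gd g∣ (suc j) m∣Δh rewrite +-suc d j =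
  Δ¹^-∤-at m∤gd g∣ j
    (subst (m ∣ℤ_) difference (∣m∣n⇒∣m-n (Δ¹^-∣-beyond g∣ j (suc (d + j)) ≤-refl) m∣Δh))
  where
  h : Seq
  h = Δ 1 ^[ j ] g
  difference : h (suc (d + j)) ℤ.- Δ 1 h (suc (d + j)) ≡ h (d + j)
  difference = trans (x-[x-y]≡y (h (suc (d + j))) (shift 1 h (suc (d + j)))) (shift-≤ h (s≤s z≤n))
    where
    x-[x-y]≡y : ∀ x y → x ℤ.- (x ℤ.- y) ≡ y
    x-[x-y]≡y = solve-∀

shift¹-∣ : ∀ {m h n} → (∀ i → i < n → m ∣ℤ h i) → m ∣ℤ shift 1 h n
shift¹-∣ {m} {h} {zero}  _  = subst (m ∣ℤ_) (sym (shift-> h (s≤s (z≤n {0})))) ∣ℤ0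
shift¹-∣ {m} {h} {suc n} h∣ = subst (m ∣ℤ_) (sym (shift-≤ h (s≤s z≤n))) (h∣ n ≤-refl)

Δ¹^-∣-before : ∀ {m g n} → (∀ i → i < n → m ∣ℤ g i) → ∀ j i → i < n → m ∣ℤ (Δ 1 ^[ j ] g) i
Δ¹^-∣-before g∣ zero    = g∣
Δ¹^-∣-before g∣ (suc j) i i<n =
  ∣m∣n⇒∣m-n (Δ¹^-∣-before g∣ j i i<n) (shift¹-∣ (λ l l<i → Δ¹^-∣-before g∣ j l (<-trans l<i i<n)))

Δ¹^-≡-at : ∀ {m g n} → (∀ i → i < n → m ∣ℤ g i) → ∀ j → m ∣ℤ (Δ 1 ^[ j ] g) n ℤ.- g n
Δ¹^-≡-at {m} {g} {n} g∣ zero    = subst (m ∣ℤ_) (sym (ℤₚ.+-inverseʳ (g n))) ∣ℤ0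
Δ¹^-≡-at {m} {g} {n} g∣ (suc j) =
  subst (m ∣ℤ_) (regroup (h n) (g n) (shift 1 h n))
        (∣m∣n⇒∣m-n (Δ¹^-≡-at g∣ j) (shift¹-∣ (Δ¹^-∣-before g∣ j)))
  where
  h : Seq
  h = Δ 1 ^[ j ] g
  regroup : ∀ x y s → x ℤ.- y ℤ.- s ≡ x ℤ.- s ℤ.- y
  regroup = solve-∀

Δ¹^-at-0 : ∀ j f → (Δ 1 ^[ j ] f) 0 ≡ f 0
Δ¹^-at-0 zero    f = refl
Δ¹^-at-0 (suc j) f =
  trans (cong₂ ℤ._-_ (Δ¹^-at-0 j f) (shift-> (Δ 1 ^[ j ] f) (s≤s (z≤n {0})))) (ℤₚ.+-identityʳ (f 0))

-- (1 - x)ʲ is a polynomial of degree j: read divisibility by 0 as vanishing.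
Δ¹^-δ-vanishes : ∀ j n → j < n → (Δ 1 ^[ j ] δ) n ≡ 0ℤ
Δ¹^-δ-vanishes j n j<n = 0∣⇒≡0 (Δ¹^-∣-beyond 0∣δ-beyond-0 j n j<n)
  where
  0∣δ-beyond-0 : ∀ i → 0 < i → 0ℤ ∣ℤ δ i
  0∣δ-beyond-0 (suc i) _ = ∣ℤ0

dilate-∣ : ∀ p .{{_ : NonZero p}} → 1 < p → ∀ {m H} n →
           (∀ i → i < suc n → m ∣ℤ H i) → m ∣ℤ dilate p H (suc n)
dilate-∣ p 1<p n H∣ with p ∣? suc n
... | yes (divides (suc t) 1+n≡[1+t]p) = H∣ (suc t) (subst (suc t <_) (sym 1+n≡[1+t]p) (m<m*n (suc t) p 1<p))
... | no  _                           = ∣ℤ0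

¬∣dilate⇒¬∣ : ∀ {p q f n} → ¬ q ∣ℤ dilate p f n → ∃[ t ] (n ≡ t * p × ¬ q ∣ℤ f t)
¬∣dilate⇒¬∣ {p} {n = n} q∤ with p ∣? n
... | yes (divides t n≡tp) = t , n≡tp , q∤
... | no  _                = ⊥-elim (q∤ ∣ℤ0)

Δ¹^≋dilate⇒∣ : ∀ p .{{_ : NonZero p}} → 1 < p → ∀ {m H} k →
               Δ 1 ^[ k ] H ≋ dilate p H [mod m ] → m ∣ℤ H 0 → ∀ n → m ∣ℤ H n
Δ¹^≋dilate⇒∣ p 1<p {m} {H} k H≋ m∣H0 = <-rec (λ n → m ∣ℤ H n) step
  where
  step : ∀ n → (∀ {i} → i < n → m ∣ℤ H i) → m ∣ℤ H n
  step zero    _       = m∣H0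
  step (suc n) earlier =
    subst (m ∣ℤ_) (regroup ((Δ 1 ^[ k ] H) (suc n)) (dilate p H (suc n)) (H (suc n)))
          (∣m∣n⇒∣m+n (∣m∣n⇒∣m-n (at H≋ (suc n)) (Δ¹^-≡-at (λ _ → earlier) k))
                     (dilate-∣ p 1<p n (λ _ → earlier)))
    where
    regroup : ∀ x y h → x ℤ.- y ℤ.- (x ℤ.- h) ℤ.+ y ≡ h
    regroup = solve-∀

functional-≋-unique : ∀ p .{{_ : NonZero p}} → 1 < p → ∀ {m F G} k →
                      Δ 1 ^[ k ] F ≋ dilate p F [mod m ] → Δ 1 ^[ k ] G ≋ dilate p G [mod m ] →
                      F 0 ≡ G 0 → F ≋ G [mod m ]
functional-≋-unique p 1<p {m} {F} {G} k F≋ G≋ F0≡G0 =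
  pointwise (Δ¹^≋dilate⇒∣ p 1<p k (pointwise H-functional) (subst (m ∣ℤ_) (sym (ℤₚ.i≡j⇒i-j≡0 F0≡G0)) ∣ℤ0))
  where
  H : Seq
  H = F ⊖ G
  H-functional : ∀ n → m ∣ℤ (Δ 1 ^[ k ] H) n ℤ.- dilate p H n
  H-functional n = subst (m ∣ℤ_) difference (∣m∣n⇒∣m-n (at F≋ n) (at G≋ n))
    where
    difference : (Δ 1 ^[ k ] F) n ℤ.- dilate p F n ℤ.- ((Δ 1 ^[ k ] G) n ℤ.- dilate p G n)
                 ≡ (Δ 1 ^[ k ] H) n ℤ.- dilate p H n
    difference = trans (regroup ((Δ 1 ^[ k ] F) n) (dilate p F n) ((Δ 1 ^[ k ] G) n) (dilate p G n))
                       (sym (cong₂ ℤ._-_ (⊖-hom (^[]-linear (Δ-linear 1) k) F G n) (⊖-hom (dilate-linear p) F G n)))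
      where
      regroup : ∀ a b c d → a ℤ.- b ℤ.- (c ℤ.- d) ≡ a ℤ.- c ℤ.- (b ℤ.- d)
      regroup = solve-∀

last-counterexample : ∀ {ℓ} {P : Pred ℕ ℓ} → Decidable P → ¬ P 0 → ∀ B → (∀ i → B ≤ i → P i) →
                      ∃[ d ] (¬ P d × (∀ i → d < i → P i))
last-counterexample P? ¬P0 zero P-from-0 = ⊥-elim (¬P0 (P-from-0 0 z≤n))
last-counterexample {P = P} P? ¬P0 (suc B) P-from-1+B with P? B
... | no  ¬PB = B , ¬PB , P-from-1+B
... | yes PB  = last-counterexample P? ¬P0 B P-from-B
  where
  P-from-B : ∀ i → B ≤ i → P i
  P-from-B i B≤i with m≤n⇒m<n∨m≡n B≤i
  ... | inj₁ B<i  = P-from-1+B i B<i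
  ... | inj₂ refl = PB

-- The divisibility p - 1 ∣ k

module _ (p : ℕ) .{{_ : NonTrivial p}} (m : ℕ) where

  private
    k : ℕ
    k = suc m
    instance
      p-nonZero : NonZero p
      p-nonZero = nonTrivial⇒nonZero p

  last-∤⇒d+k≡dp : ∀ {q} d → ¬ q ∣ℤ Aℤ p k d → (∀ i → d < i → q ∣ℤ Aℤ p k i) → d + k ≡ d * p
  last-∤⇒d+k≡dp {q} d q∤Ad q∣A = ≤-antisym d+k≤dp dp≤d+k
    where
    d+k≤dp : d + k ≤ d * p
    d+k≤dp with ¬∣dilate⇒¬∣ (subst (λ x → ¬ q ∣ℤ x) (A-functional p m (d + k)) (Δ¹^-∤-at q∤Ad q∣A k))
    ... | t , d+k≡tp , q∤At = subst (_≤ d * p) (sym d+k≡tp) (*-monoˡ-≤ p (≮⇒≥ (q∤At ∘ q∣A t)))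
    dp≤d+k : d * p ≤ d + k
    dp≤d+k = ≮⇒≥ λ d+k<dp → q∤Ad (subst (q ∣ℤ_) (trans (A-functional p m (d * p)) (dilate-* p (Aℤ p k) d))
                                                 (Δ¹^-∣-beyond q∣A k (d * p) d+k<dp))

  eventually-∣A⇒p∸1∣k : ∀ {q} N → (∀ n → N ≤ n → q ∣ℤ Aℤ p k n) → ¬ q ∣ℤ 1ℤ → p ∸ 1 ∣ k
  eventually-∣A⇒p∸1∣k {q} N q∣A q∤1
    with last-counterexample (λ i → q ∣ℤ? Aℤ p k i) (subst (λ x → ¬ q ∣ℤ + x) (sym (A-zero p m)) q∤1) N q∣A
  ... | d , q∤Ad , q∣A-beyond = divides d (begin
    k               ≡⟨ m+n∸m≡n d k ⟨
    d + k ∸ d       ≡⟨ cong (_∸ d) (last-∤⇒d+k≡dp d q∤Ad q∣A-beyond) ⟩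
    d * p ∸ d       ≡⟨ cong (d * p ∸_) (*-identityʳ d) ⟨
    d * p ∸ d * 1   ≡⟨ *-distribˡ-∸ d p 1 ⟨
    d * (p ∸ 1)     ∎)
    where open ≡-Reasoning

-- The case p ∣ k

p∤p∸1 : ∀ p → 1 < p → ¬ p ∣ p ∸ 1
p∤p∸1 (suc (suc r)) _        p∣p∸1 = <⇒≱ (n<1+n (suc r)) (∣⇒≤ p∣p∸1)
p∤p∸1 (suc zero)    (s≤s ())

module _ (p : ℕ) (p-prime : Prime p) (p-odd : ¬ 2 ∣ p) where

  private
    instance
      p-nonTrivial : NonTrivial p
      p-nonTrivial = prime⇒nonTrivial p-prime
      p-nonZero : NonZero p
      p-nonZero = prime⇒nonZero p-prime
    p² : ℤ
    p² = + p ℤ.* + p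

  Δ¹^[p²]≋Δ^[p] : ∀ f → Δ 1 ^[ p * p ] f ≋ Δ p ^[ p ] f [mod p² ]
  Δ¹^[p²]≋Δ^[p] f = ≋-respˡ (λ n → cong (λ h → h n) (sym (^[]-* (Δ 1) p p f)))
    (lift-exponent (^[]-linear (Δ-linear 1) p) (Δ-linear p) (^[]-comm (Δ-linear 1) (Δ-comm 1 p) p) p
                   (frobenius p-prime p-odd) f)

  Δ¹^δ-functional : ∀ e k → k + e * p ≡ e * (p * p) →
                    Δ 1 ^[ k ] Δ 1 ^[ e * p ] δ ≋ dilate p (Δ 1 ^[ e * p ] δ) [mod p² ]
  Δ¹^δ-functional e k k+ep≡ep² =
    ≋-respˡ (λ n → cong (λ h → h n) (sym Δ¹^k-G)) (≋-respʳ dilate-G (^[]-≋ LΔ¹^p² Δ¹^[p²]≋Δ^[p] e δ))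
    where
    LΔ¹^p² : Linear (Δ 1 ^[ p * p ]_)
    LΔ¹^p² = ^[]-linear (Δ-linear 1) (p * p)
    Δ¹^k-G : Δ 1 ^[ k ] Δ 1 ^[ e * p ] δ ≡ (Δ 1 ^[ p * p ]_) ^[ e ] δ
    Δ¹^k-G = begin
      Δ 1 ^[ k ] Δ 1 ^[ e * p ] δ  ≡⟨ ^[]-+ (Δ 1) k (e * p) δ ⟨
      Δ 1 ^[ k + e * p ] δ         ≡⟨ cong (λ i → Δ 1 ^[ i ] δ) k+ep≡ep² ⟩
      Δ 1 ^[ e * (p * p) ] δ       ≡⟨ ^[]-* (Δ 1) e (p * p) δ ⟩
      (Δ 1 ^[ p * p ]_) ^[ e ] δ   ∎
      where open ≡-Reasoning
    dilate-G : (Δ p ^[ p ]_) ^[ e ] δ ≗ dilate p (Δ 1 ^[ e * p ] δ)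
    dilate-G n = begin
      ((Δ p ^[ p ]_) ^[ e ] δ) n           ≡⟨ cong (λ h → h n) (^[]-* (Δ p) e p δ) ⟨
      (Δ p ^[ e * p ] δ) n                 ≡⟨ cong-≗ (^[]-linear (Δ-linear p) (e * p)) (dilate-δ p) n ⟨
      (Δ p ^[ e * p ] dilate p δ) n        ≡⟨ cong (λ q → (Δ q ^[ e * p ] dilate p δ) n) (*-identityʳ p) ⟨
      (Δ (p * 1) ^[ e * p ] dilate p δ) n  ≡⟨ Δ^-dilate p 1 (e * p) δ n ⟩
      dilate p (Δ 1 ^[ e * p ] δ) n        ∎
      where open ≡-Reasoning

  A≋Δ¹^δ : ∀ m e → suc m ≡ e * p * (p ∸ 1) → Aℤ p (suc m) ≋ Δ 1 ^[ e * p ] δ [mod p² ]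
  A≋Δ¹^δ m e k≡ep[p∸1] =
    functional-≋-unique p (nonTrivial⇒n>1 p) (suc m) (≗⇒≋ (A-functional p m)) (Δ¹^δ-functional e (suc m) k+ep≡ep²)
                        (trans (cong +_ (A-zero p m)) (sym (Δ¹^-at-0 (e * p) δ)))
    where
    k+ep≡ep² : suc m + e * p ≡ e * (p * p)
    k+ep≡ep² = begin
      suc m + e * p                ≡⟨ cong₂ _+_ k≡ep[p∸1] (sym (*-identityʳ (e * p))) ⟩
      e * p * (p ∸ 1) + e * p * 1  ≡⟨ *-distribˡ-+ (e * p) (p ∸ 1) 1 ⟨
      e * p * (p ∸ 1 + 1)          ≡⟨ cong (e * p *_) (m∸n+n≡m (<⇒≤ (nonTrivial⇒n>1 p))) ⟩
      e * p * p                    ≡⟨ *-assoc e p p ⟩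
      e * (p * p)                  ∎
      where open ≡-Reasoning

  p²∣A : ∀ m e → suc m ≡ e * p * (p ∸ 1) → ∀ n → e * p < n → p * p ∣ A p (suc m) n
  p²∣A m e k≡ep[p∸1] n ep<n = subst (_∣ A p (suc m) n) (ℤₚ.abs-* (+ p) (+ p))
    (∣⇒∣ᵤ (subst (p² ∣ℤ_) A-G≡A (at (A≋Δ¹^δ m e k≡ep[p∸1]) n)))
    where
    A-G≡A : Aℤ p (suc m) n ℤ.- (Δ 1 ^[ e * p ] δ) n ≡ Aℤ p (suc m) n
    A-G≡A = trans (cong (ℤ._-_ (Aℤ p (suc m) n)) (Δ¹^-δ-vanishes (e * p) n ep<n))
                  (ℤₚ.+-identityʳ (Aℤ p (suc m) n))

  p∤k : ∀ m → (∃[ N ] ∀ n → N ≤ n → HasValuation p 1 (A p (suc m) n)) → p ∸ 1 ∣ suc m → ¬ p ∣ suc m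
  p∤k m (N , ν≡1) (divides c k≡c[p∸1]) p∣k with euclidsLemma c (p ∸ 1) p-prime (subst (p ∣_) k≡c[p∸1] p∣k)
  ... | inj₂ p∣p∸1            = p∤p∸1 p (nonTrivial⇒n>1 p) p∣p∸1
  ... | inj₁ (divides e c≡ep) = proj₂ (ν≡1 n (m≤m+n N _))
    (subst (_∣ A p (suc m) n) (cong (p *_) (sym (*-identityʳ p)))
           (p²∣A m e (trans k≡c[p∸1] (cong (_* (p ∸ 1)) c≡ep)) n (m≤n+m (suc (e * p)) N)))
    where
    n : ℕ
    n = N + suc (e * p)

corollary3p3 : (p k : ℕ) → Prime p → p ≢ 2 → 1 ≤ k →
    (∃[ N ] ((n : ℕ) → N ≤ n → HasValuation p 1 (A p k n))) →
    ((p ∸ 1 ∣ k → ¬ (p ∣ k))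
     × (¬ (p ∸ 1 ∣ k) → (k' q : ℕ) → 1 ≤ q → q ≤ p ∸ 2 →
        k ≡ (p ∸ 1) * k' + q → p ∣ k' + 1 → ¬ (p ^ 2 ∣ k' + 1)))
corollary3p3 p zero    _       _   ()
corollary3p3 p (suc m) p-prime p≢2 _ ν≡1@(N , ν≡1-beyond) =
  p∤k p p-prime (odd-prime p-prime p≢2) m ν≡1 ,
  λ p∸1∤k _ _ _ _ _ _ _ → ⊥-elim (p∸1∤k p∸1∣k)
  where
  instance
    p-nonTrivial : NonTrivial p
    p-nonTrivial = prime⇒nonTrivial p-prime
  p∣A : ∀ n → N ≤ n → + p ∣ℤ Aℤ p (suc m) n
  p∣A n N≤n = ∣ᵤ⇒∣ (subst (_∣ A p (suc m) n) (*-identityʳ p) (proj₁ (ν≡1-beyond n N≤n)))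
  p∤1 : ¬ + p ∣ℤ 1ℤ
  p∤1 p∣1 = nonTrivial⇒≢1 (∣1⇒≡1 (∣⇒∣ᵤ p∣1))
  p∸1∣k : p ∸ 1 ∣ suc m
  p∸1∣k = eventually-∣A⇒p∸1∣k p m N p∣A p∤1
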